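{- Let $(\mathbf{k},\log)$ be an ordered field with surjective logarithm and $(\mathbf{k}((G)),l)$ a series field with prelogarithmic section, with EL-series field logarithm $\mathrm{Log}$. Let $U\subseteq H$ be subgroups of $G$ satisfying $$(\dagger)\qquad \mathrm{Log}(h)<|f|\ \text{ for all } h\in H\text{ and all } f\in\mathbf{k}((H^{>U})),\ f\neq0,$$ and let $\psi:(\mathbf{k}((G)),l)\to(\mathbf{k}((G)),l)$ be a morphism. Then $\psi(U)\subseteq\psi(H)$ also satisfy $(\dagger)$, i.e. $\mathrm{Log}(h)<|f|$ for all $h\in\psi(H)$ and all nonzero $f\in\mathbf{k}((\psi(H)^{>\psi(U)}))$.
   Context: $\mathbf{k}((G))$: generalized power series $\sum_{g\in G}\alpha(g)g$ with coefficients in $\mathbf{k}$ and anti-well-ordered support, ordered anti-lexicographically; $\mathbf{k}((S))$ = series with support in $S$; $H^{>U}=\{h\in H:h>u\ \forall u\in U\}$. $\log:(\mathbf{k}^{>0},\cdot)\to(\mathbf{k},+)$ is an order-preserving group isomorphism. A prelogarithmic section is an order-preserving group embedding $l:(G,\cdot)\to(\mathbf{k}((G^{>1})),+)$; on $G$, $\mathrm{Log}$ agrees with $l$ (where $\mathrm{Log}$ is the logarithm of the EL-series field $\mathbf{k}((G))^{\mathrm{EL}}$ obtained from $(\mathbf{k}((G)),l)$ by iterated exponential extension, extending the prelogarithm $L(g\,a\,(1+\varepsilon))=l(g)+\log a+\sum_{i\ge1}(-1)^{i-1}\varepsilon^i/i$). A morphism $\psi$ from $(\mathbf{k}((G)),l)$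 to itself is an order-preserving group embedding $\psi:G\to G$ such that $\psi\circ l=l\circ\psi$ on $G$, where $\psi$ is extended to series termwise by $\psi(\sum a_gg)=\sum a_g\psi(g)$. -}

module Defs where

open import Data.Product using (Σ; ∃; _×_; _,_; proj₁; proj₂)
open import Data.Sum using (_⊎_)
open import Relation.Binary.PropositionalEquality using (_≡_; _≢_)
open import Relation.Nullary using (¬_)
open import Relation.Binary.Definitions using (Trichotomous)

record OrderedField : Set₁ where
  field
    K : Set
    0# 1# : K
    _+_ _*_ : K → K → K
    -_ : K → K
    _<_ : K → K → Set
    +-assoc : ∀ x y z → (x + y) + z ≡ x + (y + z)
    +-comm : ∀ x y → x + y ≡ y + x
    +-identityˡ : ∀ x → 0# + x ≡ x
    -‿inverseˡ : ∀ x → (- x) + x ≡ 0#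
    *-assoc : ∀ x y z → (x * y) * z ≡ x * (y * z)
    *-comm : ∀ x y → x * y ≡ y * x
    *-identityˡ : ∀ x → 1# * x ≡ x
    distribˡ : ∀ x y z → x * (y + z) ≡ (x * y) + (x * z)
    0≢1 : 0# ≢ 1#
    *-inverse : ∀ x → x ≢ 0# → ∃ λ y → y * x ≡ 1#
    <-irrefl : ∀ x → ¬ (x < x)
    <-trans : ∀ {x y z} → x < y → y < z → x < z
    <-tri : Trichotomous _≡_ _<_
    +-mono-< : ∀ x y z → x < y → (x + z) < (y + z)
    *-pos : ∀ x y → 0# < x → 0# < y → 0# < (x * y)

record SurjLog (k : OrderedField) : Set where
  open OrderedField k
  Pos : Set
  Pos = Σ K (0# <_)
  field
    log : Pos → K
    log-hom : ∀ (x y : Pos) →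
      log (proj₁ x * proj₁ y , *-pos _ _ (proj₂ x) (proj₂ y)) ≡ log x + log y
    log-mono : ∀ (x y : Pos) → proj₁ x < proj₁ y → log x < log y
    log-surj : ∀ (y : K) → ∃ λ (x : Pos) → log x ≡ y

record OrderedGroup : Set₁ where
  field
    G : Set
    e : G
    _·_ : G → G → G
    _⁻¹ : G → G
    _<_ : G → G → Set
    ·-assoc : ∀ x y z → (x · y) · z ≡ x · (y · z)
    ·-comm : ∀ x y → x · y ≡ y · x
    ·-identityˡ : ∀ x → e · x ≡ x
    ⁻¹-inverseˡ : ∀ x → (x ⁻¹) · x ≡ e
    <-irrefl : ∀ x → ¬ (x < x)
    <-trans : ∀ {x y z} → x < y → y < z → x < z
    <-tri : Trichotomous _≡_ _<_
    ·-mono-< : ∀ x y z → x < y → (x · z) < (y · z)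

module _ (k : OrderedField) (Γ : OrderedGroup) where
  open OrderedField k
  open OrderedGroup Γ renaming (_<_ to _<G_)

  Coeff : Set
  Coeff = G → K

  AntiWellOrderedSupport : Coeff → Set₁
  AntiWellOrderedSupport α =
    (P : G → Set) → (∃ λ g → P g × α g ≢ 0#) →
    ∃ λ m → (P m × α m ≢ 0#) × (∀ g → P g → α g ≢ 0# → ¬ (m <G g))

  Series : Set₁
  Series = Σ Coeff AntiWellOrderedSupport

  coeff : Series → Coeff
  coeff = proj₁

  SupportIn : Series → (G → Set) → Set
  SupportIn f S = ∀ g → coeff f g ≢ 0# → S g

  NonZeroS : Series → Set
  NonZeroS f = ¬ (∀ g → coeff f g ≡ 0#)

  _<ₛ_ : Coeff → Coeff → Set
  α <ₛ β = ∃ λ g → (α g < β g) × (∀ g' → g <G g' → α g' ≡ β g')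

  _≤ₛ_ : Coeff → Coeff → Set
  α ≤ₛ β = (α <ₛ β) ⊎ (∀ g → α g ≡ β g)

  zeroC : Coeff
  zeroC _ = 0#

  negC : Coeff → Coeff
  negC α g = - (α g)

  _<∣_∣ : Coeff → Coeff → Set
  α <∣ β ∣ = (zeroC ≤ₛ β × α <ₛ β) ⊎ (β <ₛ zeroC × α <ₛ negC β)

  record PrelogSection : Set₁ where
    field
      l : G → Series
      l-supp : ∀ g → SupportIn (l g) (λ x → e <G x)
      l-hom : ∀ g h x → coeff (l (g · h)) x ≡ coeff (l g) x + coeff (l h) x
      l-inj : ∀ g h → (∀ x → coeff (l g) x ≡ coeff (l h) x) → g ≡ h
      l-mono : ∀ g h → g <G h → coeff (l g) <ₛ coeff (l h)

  record Subgroup (S : G → Set) : Set where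
    field
      has-e : S e
      ·-closed : ∀ {x y} → S x → S y → S (x · y)
      ⁻¹-closed : ∀ {x} → S x → S (x ⁻¹)

  Above : (H U : G → Set) → G → Set
  Above H U h = H h × (∀ u → U u → u <G h)

  Image : (G → G) → (G → Set) → G → Set
  Image ψ S y = ∃ λ x → S x × ψ x ≡ y

  -- condition (†), with Log(h) = l(h) for h ∈ G
  Dagger : PrelogSection → (U H : G → Set) → Set₁
  Dagger L U H = ∀ h → H h → (f : Series) → SupportIn f (Above H U) → NonZeroS f →
    coeff (PrelogSection.l L h) <∣ coeff f ∣

  -- morphism (k((G)),l) → (k((G)),l): order-preserving group embedding ψ : G → G
  -- with ψ ∘ l = l ∘ ψ, ψ extended termwise to series.
  record Morphism (L : PrelogSection) : Set where
    open PrelogSection L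
    field
      ψ : G → G
      ψ-hom : ∀ x y → ψ (x · y) ≡ ψ x · ψ y
      ψ-inj : ∀ x y → ψ x ≡ ψ y → x ≡ y
      ψ-mono : ∀ x y → x <G y → ψ x <G ψ y
      comm-on-image : ∀ g x → coeff (l (ψ g)) (ψ x) ≡ coeff (l g) x
      comm-off-image : ∀ g y → (∀ x → ψ x ≢ y) → coeff (l (ψ g)) y ≡ 0#

-- Every
-- inequality in (†) compares coefficient functions anti-lexicographically,
-- and such comparisons are invariant under termwise transport along a
-- strictly increasing map.  So, given h ∈ H and a nonzero series f supported
-- in ψ(H)^{>ψ(U)}, we pull f back to f ∘ ψ: it is again a series (its support
-- is anti-well-ordered), it is nonzero, and it is supported in H^{>U}.
-- Condition (†) for U ⊆ H gives l(h) < |f ∘ ψ|, and transporting this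
-- inequality along ψ yields Log(ψ h) = l(ψ h) < |f|.
module Submission where

open import Defs
open import Relation.Binary.PropositionalEquality using (_≡_; _≢_; refl; sym; trans; cong; subst; subst₂)
open import Data.Product using (∃; _×_; _,_; proj₁; proj₂)
open import Data.Sum using (inj₁; inj₂)
open import Data.Empty using (⊥-elim)
open import Relation.Nullary using (¬_)
open import Relation.Nullary.Decidable using (decidable-stable)
open import Relation.Binary.Consequences using (tri⇒dec≈)
open import Relation.Binary.Definitions using (tri<; tri≈; tri>)

module FieldFacts (k : OrderedField) where
  open OrderedField k

  -- Equality in an ordered field is decidable (by trichotomy), hence stable
  -- under double negation; this replaces case analysis on "is a coefficient zero".
  ≡-stable : ∀ (a b : K) → ¬ ¬ (a ≡ b) → a ≡ b
  ≡-stable a b = decidable-stable (tri⇒dec≈ <-tri a b)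

  -0≡0 : - 0# ≡ 0#
  -0≡0 = trans (sym (+-identityˡ (- 0#))) (trans (+-comm 0# (- 0#)) (-‿inverseˡ 0#))

module Transport (k : OrderedField) (Γ : OrderedGroup)
                 (ψ : OrderedGroup.G Γ → OrderedGroup.G Γ)
                 (ψ-mono : ∀ x y → OrderedGroup._<_ Γ x y → OrderedGroup._<_ Γ (ψ x) (ψ y)) where
  open OrderedField k
  open OrderedGroup Γ renaming (_<_ to _<G_; <-irrefl to <G-irrefl; <-trans to <G-trans; <-tri to <G-tri)
  open FieldFacts k

  ψ-reflects-< : ∀ a b → ψ a <G ψ b → a <G b
  ψ-reflects-< a b ψa<ψb with <G-tri a b
  ... | tri< a<b _ _ = a<b
  ... | tri≈ _ refl _ = ⊥-elim (<G-irrefl _ ψa<ψb)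
  ... | tri> _ _ b<a = ⊥-elim (<G-irrefl _ (<G-trans ψa<ψb (ψ-mono b a b<a)))

  -- α is the termwise image ψ(α') of α': it equals α' along ψ and vanishes
  -- off the image of ψ.
  _IsImageOf_ : Coeff k Γ → Coeff k Γ → Set
  α IsImageOf α' = (∀ x → α (ψ x) ≡ α' x) × (∀ y → (∀ x → ψ x ≢ y) → α y ≡ 0#)

  zero-image : zeroC k Γ IsImageOf zeroC k Γ
  zero-image = (λ _ → refl) , (λ _ _ → refl)

  neg-image : ∀ {α α'} → α IsImageOf α' → negC k Γ α IsImageOf negC k Γ α'
  neg-image (along , off) =
    (λ x → cong -_ (along x)) , (λ y y∉im → trans (cong -_ (off y y∉im)) -0≡0)

  -- Two images agree at y as soon as their preimages agree at every ψ-preimage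
  -- of y (off the image both vanish).
  image-agree : ∀ {α α' β β'} → α IsImageOf α' → β IsImageOf β' → ∀ y →
                (∀ x → ψ x ≡ y → α' x ≡ β' x) → α y ≡ β y
  image-agree {α} {α'} {β} {β'} (α-along , α-off) (β-along , β-off) y agree =
    ≡-stable (α y) (β y) λ αy≢βy →
      let y∉im : ∀ x → ψ x ≢ y
          y∉im x ψx≡y = αy≢βy (on-image x ψx≡y)
      in αy≢βy (trans (α-off y y∉im) (sym (β-off y y∉im)))
    where
    on-image : ∀ x → ψ x ≡ y → α y ≡ β y
    on-image x refl = trans (α-along x) (trans (agree x refl) (sym (β-along x)))

  -- If α' <ₛ β' is witnessed at g, then ψ(α') <ₛ ψ(β') is witnessed at ψ g.
  image-<ₛ : ∀ {α α' β β'} → α IsImageOf α' → β IsImageOf β' →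
             _<ₛ_ k Γ α' β' → _<ₛ_ k Γ α β
  image-<ₛ α-img β-img (g , α'g<β'g , agree-above) =
    ψ g ,
    subst₂ _<_ (sym (proj₁ α-img g)) (sym (proj₁ β-img g)) α'g<β'g ,
    λ y ψg<y → image-agree α-img β-img y λ x ψx≡y →
      agree-above x (ψ-reflects-< g x (subst (ψ g <G_) (sym ψx≡y) ψg<y))

  image-≤ₛ : ∀ {α α' β β'} → α IsImageOf α' → β IsImageOf β' →
             _≤ₛ_ k Γ α' β' → _≤ₛ_ k Γ α β
  image-≤ₛ α-img β-img (inj₁ α'<β') = inj₁ (image-<ₛ α-img β-img α'<β')
  image-≤ₛ α-img β-img (inj₂ α'≡β') =
    inj₂ (λ y → image-agree α-img β-img y (λ x _ → α'≡β' x))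

  image-<∣∣ : ∀ {α α' β β'} → α IsImageOf α' → β IsImageOf β' →
              _<∣_∣ k Γ α' β' → _<∣_∣ k Γ α β
  image-<∣∣ α-img β-img (inj₁ (0≤β' , α'<β')) =
    inj₁ (image-≤ₛ zero-image β-img 0≤β' , image-<ₛ α-img β-img α'<β')
  image-<∣∣ α-img β-img (inj₂ (β'<0 , α'<-β')) =
    inj₂ (image-<ₛ β-img zero-image β'<0 , image-<ₛ α-img (neg-image β-img) α'<-β')

module Pullback (k : OrderedField) (Γ : OrderedGroup)
                (ψ : OrderedGroup.G Γ → OrderedGroup.G Γ)
                (ψ-mono : ∀ x y → OrderedGroup._<_ Γ x y → OrderedGroup._<_ Γ (ψ x) (ψ y))
                (f : Series k Γ)
                (supp-in-image : SupportIn k Γ f (λ y → ∃ λ x → ψ x ≡ y)) where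
  open OrderedField k
  open OrderedGroup Γ using (G)
  open FieldFacts k
  open Transport k Γ ψ ψ-mono

  -- The support of f ∘ ψ is anti-well-ordered: the maximum of a subset P is
  -- the preimage of the maximum of ψ(P) in the support of f.
  pullback-awo : AntiWellOrderedSupport k Γ (λ x → coeff k Γ f (ψ x))
  pullback-awo P (x , Px , fψx≢0)
    with proj₂ f (λ y → ∃ λ z → P z × ψ z ≡ y) (ψ x , (x , Px , refl) , fψx≢0)
  ... | .(ψ m) , ((m , Pm , refl) , fψm≢0) , maximal =
    m , (Pm , fψm≢0) , λ g Pg fψg≢0 m<g → maximal (ψ g) (g , Pg , refl) fψg≢0 (ψ-mono m g m<g)

  pullback : Series k Γ
  pullback = (λ x → coeff k Γ f (ψ x)) , pullback-awo

  -- Since f vanishes off the image of ψ, f is the termwise image of its pullback.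
  image-of-pullback : coeff k Γ f IsImageOf coeff k Γ pullback
  image-of-pullback = (λ _ → refl) , off-image
    where
    off-image : ∀ y → (∀ x → ψ x ≢ y) → coeff k Γ f y ≡ 0#
    off-image y y∉im = ≡-stable _ _ λ fy≢0 →
      let (x , ψx≡y) = supp-in-image y fy≢0 in y∉im x ψx≡y

  pullback-nonzero : NonZeroS k Γ f → NonZeroS k Γ pullback
  pullback-nonzero f≢0 pullback≡0 =
    f≢0 λ y → image-agree image-of-pullback zero-image y (λ x _ → pullback≡0 x)

  pullback-above : (ψ-inj : ∀ x y → ψ x ≡ ψ y → x ≡ y) (U H : G → Set) →
    SupportIn k Γ f (Above k Γ (Image k Γ ψ H) (Image k Γ ψ U)) →
    SupportIn k Γ pullback (Above k Γ H U)
  pullback-above ψ-inj U H f-above x fψx≢0 with f-above (ψ x) fψx≢0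
  ... | (y , Hy , ψy≡ψx) , above-ψU =
    subst H (ψ-inj y x ψy≡ψx) Hy ,
    λ u Uu → ψ-reflects-< u x (above-ψU (ψ u) (u , Uu , refl))

lemma8p5 : (k : OrderedField) (lg : SurjLog k) (Γ : OrderedGroup)
    (L : PrelogSection k Γ) (U H : OrderedGroup.G Γ → Set) →
    Subgroup k Γ U → Subgroup k Γ H → (∀ u → U u → H u) →
    Dagger k Γ L U H →
    (M : Morphism k Γ L) →
    Dagger k Γ L (Image k Γ (Morphism.ψ M) U) (Image k Γ (Morphism.ψ M) H)
lemma8p5 k _ Γ L U H _ _ _ dagger M .(Morphism.ψ M h) (h , Hh , refl) f f-above f≢0 =
  image-<∣∣ l-ψh-image image-of-pullback l-h<∣pullback∣
  where
  open Morphism M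
  open Transport k Γ ψ ψ-mono

  l-ψh-image : coeff k Γ (PrelogSection.l L (ψ h)) IsImageOf coeff k Γ (PrelogSection.l L h)
  l-ψh-image = comm-on-image h , comm-off-image h

  f-in-image : SupportIn k Γ f (λ y → ∃ λ x → ψ x ≡ y)
  f-in-image y fy≢0 = let (x , _ , ψx≡y) = proj₁ (f-above y fy≢0) in x , ψx≡y

  open Pullback k Γ ψ ψ-mono f f-in-image

  l-h<∣pullback∣ : _<∣_∣ k Γ (coeff k Γ (PrelogSection.l L h)) (coeff k Γ pullback)
  l-h<∣pullback∣ = dagger h Hh pullback (pullback-above ψ-inj U H f-above) (pullback-nonzero f≢0)
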